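{- Let $X$ be an orthomodular lattice. For each $a\in X$ the morphism $a\colon{\downarrow}a\to X$ in $\mathbf{OMLatGal}$ (with $a_*(u)=u^\perp$, $a^*(x)=a\wedge x^\perp$) is a dagger kernel, and the assignment $a\mapsto(a\colon{\downarrow}a\to X)$ is an isomorphism of orthomodular lattices $X\cong\mathrm{KSub}(X)$. This isomorphism is natural in the sense that for every morphism $f\colon X\to Y$ of $\mathbf{OMLatGal}$, under these isomorphisms $\exists_f\colon\mathrm{KSub}(X)\to\mathrm{KSub}(Y)$ corresponds to the map $X\to Y$, $x\mapsto f_*(x)^\perp$, and $f^{ -1}\colon\mathrm{KSub}(Y)\to\mathrm{KSub}(X)$ corresponds to the map $Y\to X$, $y\mapsto f^*(y^\perp)$.
   Context: An orthomodular lattice is a bounded lattice $X$ with an orthocomplement $x\mapsto x^\perp$ ($x^{\perp\perp}=x$, order-reversing, $x\wedge x^\perp=0$) such that $x\le y$ implies $y=x\vee(x^\perp\wedge y)$. $\mathbf{OMLatGal}$: objects orthomodular lattices; morphisms $f\colon X\to Y$ are pairs $(f_*,f^*)$ of order-reversing maps $f_*\colon X\to Y$, $f^*\colon Y\to X$ with $x\le f^*(y)\iff y\le f_*(x)$; identity $((-)^\perp,(-)^\perp)$; composition $(g\circ f)_*=g_*\circ(-)^\perp\circ f_*$, $(g\circ f)^*=f^*\circ(-)^\perp\circ g^*$; dagger $(f_*,f^*)^\dagger=(f^*,f_*)$; zero object the one-element lattice. ${\downarrow}a=\{u\le a\}$ with orthocomplement $u^{\perp_a}=a\wedge u^\perp$.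 In a dagger kernel category (dagger category with zero object in which every map has a kernel that is a dagger mono, $k^\dagger k=\mathrm{id}$), $\mathrm{KSub}(X)$ is the poset of dagger kernels with codomain $X$ up to isomorphism, ordered by $m\le n$ iff $m=n\circ\varphi$ for some $\varphi$; it is an orthomodular lattice with $k^\perp=\ker(k^\dagger)$. With $\mathrm{coker}(f)=\ker(f^\dagger)^\dagger$, one sets $f^{ -1}(n)=\ker(\mathrm{coker}(n)\circ f)$ and $\exists_f(m)=\ker(\mathrm{coker}(f\circ m))$. -}

module Defs where

open import Level using (Level; suc; _⊔_; Lift; lift)
open import Data.Unit using (⊤; tt)
open import Data.Product using (Σ; Σ-syntax; _×_; _,_; proj₁; proj₂)
open import Function using (_∘′_)
open import Algebra.Core using (Op₁; Op₂)
open import Relation.Binary using (Rel; IsPartialOrder; IsPreorder; IsEquivalence)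
open import Relation.Binary.Lattice using (IsBoundedLattice; IsLattice)
import Relation.Binary.Construct.On as On

-- All components live in one universe level c (so that ↓a is again an
-- object of the same universe).

record OML (c : Level) : Set (suc c) where
  infix  4 _≈_ _≤_
  infixr 7 _∧_
  infixr 6 _∨_
  infix  8 _ᗮ
  field
    Carrier : Set c
    _≈_     : Rel Carrier c
    _≤_     : Rel Carrier c
    _∨_     : Op₂ Carrier
    _∧_     : Op₂ Carrier
    𝟏       : Carrier
    𝟎       : Carrier
    _ᗮ      : Op₁ Carrier
    isBoundedLattice : IsBoundedLattice _≈_ _≤_ _∨_ _∧_ 𝟏 𝟎
    ᗮ-involutive : ∀ x → (x ᗮ) ᗮ ≈ x
    ᗮ-antitone   : ∀ {x y} → x ≤ y → y ᗮ ≤ x ᗮ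
    ᗮ-meet       : ∀ x → x ∧ x ᗮ ≈ 𝟎
    orthomodular : ∀ {x y} → x ≤ y → y ≈ x ∨ (x ᗮ ∧ y)

  open IsBoundedLattice isBoundedLattice public

  ≤-ᗮᗮ : ∀ x → x ≤ (x ᗮ) ᗮ
  ≤-ᗮᗮ x = reflexive (Eq.sym (ᗮ-involutive x))

  ᗮᗮ-≤ : ∀ x → (x ᗮ) ᗮ ≤ x
  ᗮᗮ-≤ x = reflexive (ᗮ-involutive x)

  ᗮ-swap : ∀ {x y} → x ≤ y ᗮ → y ≤ x ᗮ
  ᗮ-swap {x} {y} p = trans (≤-ᗮᗮ y) (ᗮ-antitone p)

  ᗮ-swap′ : ∀ {x y} → x ᗮ ≤ y → y ᗮ ≤ x
  ᗮ-swap′ {x} {y} p = trans (ᗮ-antitone p) (ᗮᗮ-≤ x)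

  ∧-mono : ∀ {x y x′ y′} → x ≤ x′ → y ≤ y′ → x ∧ y ≤ x′ ∧ y′
  ∧-mono p q = ∧-greatest (trans (x∧y≤x _ _) p) (trans (x∧y≤y _ _) q)

  ∨-mono : ∀ {x y x′ y′} → x ≤ x′ → y ≤ y′ → x ∨ y ≤ x′ ∨ y′
  ∨-mono p q = ∨-least (trans p (x≤x∨y _ _)) (trans q (y≤x∨y _ _))

module _ {c : Level} where

  open OML

  -- A morphism f : X → Y is a pair (f_*, f^*) of order-reversing maps
  -- with  x ≤ f^*(y) ⇔ y ≤ f_*(x).
  record Hom (X Y : OML c) : Set c where
    field
      lower : Carrier X → Carrier Y
      upper : Carrier Y → Carrier X
      lower-antitone : ∀ {x x′} → _≤_ X x x′ → _≤_ Y (lower x′) (lower x)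
      upper-antitone : ∀ {y y′} → _≤_ Y y y′ → _≤_ X (upper y′) (upper y)
      galois⇒ : ∀ x y → _≤_ X x (upper y) → _≤_ Y y (lower x)
      galois⇐ : ∀ x y → _≤_ Y y (lower x) → _≤_ X x (upper y)

  open Hom public

  infix 4 _≃_
  _≃_ : ∀ {X Y} → Hom X Y → Hom X Y → Set c
  _≃_ {X} {Y} f g =
    (∀ x → _≈_ Y (lower f x) (lower g x)) × (∀ y → _≈_ X (upper f y) (upper g y))

  idHom : (X : OML c) → Hom X X
  idHom X = record
    { lower = _ᗮ X
    ; upper = _ᗮ X
    ; lower-antitone = ᗮ-antitone X
    ; upper-antitone = ᗮ-antitone X
    ; galois⇒ = λ x y → ᗮ-swap X
    ; galois⇐ = λ x y → ᗮ-swap X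
    }

  infixr 9 _∘_
  _∘_ : ∀ {X Y Z} → Hom Y Z → Hom X Y → Hom X Z
  _∘_ {X} {Y} {Z} g f = record
    { lower = λ x → lower g (_ᗮ Y (lower f x))
    ; upper = λ z → upper f (_ᗮ Y (upper g z))
    ; lower-antitone = λ p → lower-antitone g (ᗮ-antitone Y (lower-antitone f p))
    ; upper-antitone = λ p → upper-antitone f (ᗮ-antitone Y (upper-antitone g p))
    ; galois⇒ = λ x z p →
        galois⇒ g _ z (ᗮ-swap′ Y (galois⇒ f x _ p))
    ; galois⇐ = λ x z p →
        galois⇐ f x _ (ᗮ-swap′ Y (galois⇐ g _ z p))
    }

  infix 10 _†
  _† : ∀ {X Y} → Hom X Y → Hom Y X
  f † = record
    { lower = upper f
    ; upper = lower f
    ; lower-antitone = upper-antitone f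
    ; upper-antitone = lower-antitone f
    ; galois⇒ = λ y x → galois⇐ f x y
    ; galois⇐ = λ y x → galois⇒ f x y
    }

  𝟘 : OML c
  𝟘 = record
    { Carrier = Lift c ⊤
    ; _≈_ = λ _ _ → Lift c ⊤
    ; _≤_ = λ _ _ → Lift c ⊤
    ; _∨_ = λ _ _ → lift tt
    ; _∧_ = λ _ _ → lift tt
    ; 𝟏 = lift tt
    ; 𝟎 = lift tt
    ; _ᗮ = λ _ → lift tt
    ; isBoundedLattice = record
      { isLattice = record
        { isPartialOrder = record
          { isPreorder = record
            { isEquivalence = record { refl = lift tt ; sym = λ _ → lift tt ; trans = λ _ _ → lift tt }
            ; reflexive = λ _ → lift tt
            ; trans = λ _ _ → lift tt
            }
          ; antisym = λ _ _ → lift tt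
          }
        ; supremum = λ _ _ → lift tt , lift tt , λ _ _ _ → lift tt
        ; infimum  = λ _ _ → lift tt , lift tt , λ _ _ _ → lift tt
        }
      ; maximum = λ _ → lift tt
      ; minimum = λ _ → lift tt
      }
    ; ᗮ-involutive = λ _ → lift tt
    ; ᗮ-antitone = λ _ → lift tt
    ; ᗮ-meet = λ _ → lift tt
    ; orthomodular = λ _ → lift tt
    }

  toZero : (X : OML c) → Hom X 𝟘
  toZero X = record
    { lower = λ _ → lift tt
    ; upper = λ _ → 𝟏 X
    ; lower-antitone = λ _ → lift tt
    ; upper-antitone = λ _ → refl X
    ; galois⇒ = λ _ _ _ → lift tt
    ; galois⇐ = λ x _ _ → maximum X x
    }

  fromZero : (Y : OML c) → Hom 𝟘 Y
  fromZero Y = record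
    { lower = λ _ → 𝟏 Y
    ; upper = λ _ → lift tt
    ; lower-antitone = λ _ → refl Y
    ; upper-antitone = λ _ → lift tt
    ; galois⇒ = λ _ y _ → maximum Y y
    ; galois⇐ = λ _ _ _ → lift tt
    }

  zeroHom : (X Y : OML c) → Hom X Y
  zeroHom X Y = fromZero Y ∘ toZero X

  IsKernel : ∀ {K X Y} → Hom K X → Hom X Y → Set (suc c)
  IsKernel {K} {X} {Y} k f =
    (f ∘ k ≃ zeroHom K Y) ×
    (∀ {Z : OML c} (g : Hom Z X) → f ∘ g ≃ zeroHom Z Y →
       Σ[ φ ∈ Hom Z K ] ((k ∘ φ ≃ g) × (∀ (ψ : Hom Z K) → k ∘ ψ ≃ g → ψ ≃ φ)))

  IsDaggerMono : ∀ {K X} → Hom K X → Set c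
  IsDaggerMono {K} k = (k †) ∘ k ≃ idHom K

  IsDaggerKernel : ∀ {K X} → Hom K X → Set (suc c)
  IsDaggerKernel {K} {X} k =
    (Σ[ Y ∈ OML c ] Σ[ f ∈ Hom X Y ] IsKernel k f) × IsDaggerMono k

  IsDaggerKernelOf : ∀ {K X Y} → Hom K X → Hom X Y → Set (suc c)
  IsDaggerKernelOf k f = IsKernel k f × IsDaggerMono k

  infix 4 _⊑_
  _⊑_ : ∀ {M N X} → Hom M X → Hom N X → Set c
  _⊑_ {M} {N} m n = Σ[ φ ∈ Hom M N ] (m ≃ n ∘ φ)

module _ {c : Level} (X : OML c) where

  open OML X

  private
    ↓C : Carrier → Set c
    ↓C a = Σ[ u ∈ Carrier ] (u ≤ a)

  ↓ : Carrier → OML c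
  ↓ a = record
    { Carrier = ↓C a
    ; _≈_ = λ u v → proj₁ u ≈ proj₁ v
    ; _≤_ = λ u v → proj₁ u ≤ proj₁ v
    ; _∨_ = λ u v → (proj₁ u ∨ proj₁ v) , ∨-least (proj₂ u) (proj₂ v)
    ; _∧_ = λ u v → (proj₁ u ∧ proj₁ v) , trans (x∧y≤x _ _) (proj₂ u)
    ; 𝟏 = a , refl
    ; 𝟎 = 𝟎 , minimum a
    ; _ᗮ = λ u → (a ∧ proj₁ u ᗮ) , x∧y≤x _ _
    ; isBoundedLattice = record
      { isLattice = record
        { isPartialOrder = On.isPartialOrder proj₁ isPartialOrder
        ; supremum = λ u v → supremum (proj₁ u) (proj₁ v) .proj₁
                           , supremum (proj₁ u) (proj₁ v) .proj₂ .proj₁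
                           , λ w → supremum (proj₁ u) (proj₁ v) .proj₂ .proj₂ (proj₁ w)
        ; infimum  = λ u v → infimum (proj₁ u) (proj₁ v) .proj₁
                           , infimum (proj₁ u) (proj₁ v) .proj₂ .proj₁
                           , λ w → infimum (proj₁ u) (proj₁ v) .proj₂ .proj₂ (proj₁ w)
        }
      ; maximum = proj₂
      ; minimum = λ u → minimum (proj₁ u)
      }
    ; ᗮ-involutive = λ u → antisym (inv≤ (proj₁ u) (proj₂ u)) (≤inv (proj₁ u) (proj₂ u))
    ; ᗮ-antitone = λ p → ∧-mono refl (ᗮ-antitone p)
    ; ᗮ-meet = λ u → antisym
        (trans (∧-mono refl (x∧y≤y _ _)) (reflexive (ᗮ-meet (proj₁ u))))
        (minimum _)
    ; orthomodular = λ {u} {v} p → antisym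
        (trans (reflexive (orthomodular p))
               (∨-mono refl (∧-greatest
                   (∧-greatest (trans (x∧y≤y _ _) (proj₂ v)) (x∧y≤x _ _))
                   (x∧y≤y _ _))))
        (∨-least p (x∧y≤y _ _))
    }
    where
    ≤inv : ∀ u → u ≤ a → u ≤ a ∧ (a ∧ u ᗮ) ᗮ
    ≤inv u p = ∧-greatest p (trans (≤-ᗮᗮ u) (ᗮ-antitone (x∧y≤y _ _)))
    inv≤ : ∀ u → u ≤ a → a ∧ (a ∧ u ᗮ) ᗮ ≤ u
    inv≤ u p =
      trans
        (ᗮ-swap (∨-least
           (ᗮ-swap (trans (x∧y≤x _ _) (≤-ᗮᗮ a)))
           (ᗮ-swap (trans (x∧y≤y _ _) (ᗮ-antitone (∧-mono (ᗮᗮ-≤ a) refl))))))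
        (trans (ᗮ-antitone (reflexive (orthomodular (ᗮ-antitone p)))) (ᗮᗮ-≤ u))

  ι : (a : Carrier) → Hom (↓ a) X
  ι a = record
    { lower = λ u → proj₁ u ᗮ
    ; upper = λ x → (a ∧ x ᗮ) , x∧y≤x _ _
    ; lower-antitone = ᗮ-antitone
    ; upper-antitone = λ p → ∧-mono refl (ᗮ-antitone p)
    ; galois⇒ = λ u x p → ᗮ-swap (trans p (x∧y≤y _ _))
    ; galois⇐ = λ u x p → ∧-greatest (proj₂ u) (ᗮ-swap p)
    }

module Submission where

-- In OMLatGal a morphism h : X → W annihilates g : Z → X
-- (h ∘ g ≃ 0) exactly when every g_*(z)ᗮ lies below h^*(𝟏); and g factors
-- through a : ↓a → X exactly when every g_*(z)ᗮ lies below a.  Hence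
-- a = h^*(𝟏) gives a kernel  a : ↓a → X  of h; it is a dagger mono, and the
-- factorisation is unique because a lower adjoint determines its morphism.
-- Since any two kernels of h factor through each other, every kernel k of h
-- is isomorphic to h^*(𝟏) : ↓h^*(𝟏) → X, and its top value is
-- k_*(𝟏) ≈ h^*(𝟏)ᗮ.  The theorem then follows by computing h^*(𝟏) in each
-- case: a ↦ (a : ↓a → X) reflects and preserves order via the factorisation
-- criterion, is onto KSub(X), sends aᗮ to ker(a†), and the kernels defining
-- ∃_f(x) and f⁻¹(y) are computed from the top values of the relevant kernels.

open import Defs
open import Level using (Level)
open import Data.Product using (Σ; Σ-syntax; _×_; _,_; proj₁; proj₂)

module Orthocomplement {c : Level} (X : OML c) where
  open OML X

  ᗮ-cong : ∀ {x y} → x ≈ y → x ᗮ ≈ y ᗮ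
  ᗮ-cong p = antisym (ᗮ-antitone (reflexive (Eq.sym p))) (ᗮ-antitone (reflexive p))

  ᗮ-injective : ∀ {x y} → x ᗮ ≈ y ᗮ → x ≈ y
  ᗮ-injective {x} {y} p =
    Eq.trans (Eq.sym (ᗮ-involutive x)) (Eq.trans (ᗮ-cong p) (ᗮ-involutive y))

  ∧-congˡ : ∀ a {x y} → x ≈ y → a ∧ x ≈ a ∧ y
  ∧-congˡ a p = antisym (∧-mono refl (reflexive p)) (∧-mono refl (reflexive (Eq.sym p)))

module _ {c : Level} {Z W : OML c} where
  private
    module Z = OML Z
    module W = OML W

  lower-cong : (f : Hom Z W) → ∀ {x x′} → x Z.≈ x′ → lower f x W.≈ lower f x′
  lower-cong f p = W.antisym (lower-antitone f (Z.reflexive (Z.Eq.sym p)))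
                             (lower-antitone f (Z.reflexive p))

  upper-cong : (f : Hom Z W) → ∀ {y y′} → y W.≈ y′ → upper f y Z.≈ upper f y′
  upper-cong f p = Z.antisym (upper-antitone f (W.reflexive (W.Eq.sym p)))
                             (upper-antitone f (W.reflexive p))

  -- A Galois connection is determined by either adjoint: morphisms with
  -- the same lower part are equal.
  lower-determines : (f g : Hom Z W) → (∀ z → lower f z W.≈ lower g z) → f ≃ g
  lower-determines f g p = p , λ y → Z.antisym
    (galois⇐ g (upper f y) y (W.trans (galois⇒ f (upper f y) y Z.refl) (W.reflexive (p _))))
    (galois⇐ f (upper g y) y (W.trans (galois⇒ g (upper g y) y Z.refl) (W.reflexive (W.Eq.sym (p _)))))

  ≃-sym : (f g : Hom Z W) → f ≃ g → g ≃ f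
  ≃-sym f g (p , q) = (λ x → W.Eq.sym (p x)) , (λ y → Z.Eq.sym (q y))

  ≃-trans : (f g h : Hom Z W) → f ≃ g → g ≃ h → f ≃ h
  ≃-trans f g h (p , q) (p′ , q′) = (λ x → W.Eq.trans (p x) (p′ x)) , (λ y → Z.Eq.trans (q y) (q′ y))

kernels-comparable : ∀ {c} {K K′ X W : OML c} (k : Hom K X) (k′ : Hom K′ X) (h : Hom X W) →
                     IsKernel k h → IsKernel k′ h → k ⊑ k′
kernels-comparable k k′ h (k-zero , _) (_ , k′-universal) =
  let (φ , k′φ≃k , _) = k′-universal k k-zero in φ , ≃-sym (k′ ∘ φ) k k′φ≃k

top-least : ∀ {c} {C M X : OML c} (k : Hom C X) (m : Hom M X) →
            m ⊑ k → ∀ z → OML._≤_ X (lower k (OML.𝟏 C)) (lower m z)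
top-least {C = C} {X = X} k m (φ , m≃kφ) z =
  OML.trans X (lower-antitone k (OML.maximum C _)) (OML.reflexive X (OML.Eq.sym X (proj₁ m≃kφ z)))

module Kernels {c : Level} (X : OML c) where
  open OML X
  open Orthocomplement X

  annihilates⇒ : ∀ {Z W : OML c} (h : Hom X W) (g : Hom Z X) →
                 h ∘ g ≃ zeroHom Z W → ∀ z → lower g z ᗮ ≤ upper h (OML.𝟏 W)
  annihilates⇒ {W = W} h g hg≃0 z =
    galois⇐ h (lower g z ᗮ) (OML.𝟏 W) (OML.reflexive W (OML.Eq.sym W (proj₁ hg≃0 z)))

  annihilates⇐ : ∀ {Z W : OML c} (h : Hom X W) (g : Hom Z X) →
                 (∀ z → lower g z ᗮ ≤ upper h (OML.𝟏 W)) → h ∘ g ≃ zeroHom Z W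
  annihilates⇐ {Z} {W} h g below = lower-determines (h ∘ g) (zeroHom Z W) λ z →
    OML.antisym W (OML.maximum W _) (galois⇒ h _ (OML.𝟏 W) (below z))

  ι-factor : ∀ {Z : OML c} b (g : Hom Z X) → (∀ z → lower g z ᗮ ≤ b) →
             ι X b ∘ (ι X b † ∘ g) ≃ g
  ι-factor b g below = lower-determines (ι X b ∘ (ι X b † ∘ g)) g λ z →
    Eq.trans (ᗮ-cong (OML.ᗮ-involutive (↓ X b) (lower g z ᗮ , below z)))
             (ᗮ-involutive (lower g z))

  below⇒⊑ι : ∀ {Z : OML c} b (g : Hom Z X) → (∀ z → lower g z ᗮ ≤ b) → g ⊑ ι X b
  below⇒⊑ι b g below = (ι X b † ∘ g) , ≃-sym (ι X b ∘ (ι X b † ∘ g)) g (ι-factor b g below)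

  ⊑ι⇒below : ∀ {Z : OML c} b (g : Hom Z X) → g ⊑ ι X b → ∀ z → lower g z ᗮ ≤ b
  ⊑ι⇒below b g (φ , g≃bφ) z =
    trans (reflexive (ᗮ-cong (proj₁ g≃bφ z))) (trans (ᗮᗮ-≤ _) (x∧y≤x _ _))

  -- b : ↓b → X is monic: the lower part of b ∘ ψ is z ↦ (b ∧ ψ_*(z)ᗮ)ᗮ,
  -- from which ψ_*(z) is recovered by cancelling ᗮ in X and then in ↓b.
  ι-monic : ∀ {Z : OML c} b (ψ φ : Hom Z (↓ X b)) → ι X b ∘ ψ ≃ ι X b ∘ φ → ψ ≃ φ
  ι-monic b ψ φ bψ≃bφ = lower-determines ψ φ λ z →
    Orthocomplement.ᗮ-injective (↓ X b) {lower ψ z} {lower φ z} (ᗮ-injective (proj₁ bψ≃bφ z))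

  ι-dagger-mono : ∀ b → IsDaggerMono (ι X b)
  ι-dagger-mono b = lower-determines (ι X b † ∘ ι X b) (idHom (↓ X b)) λ u →
    ∧-congˡ b (ᗮ-cong (ᗮ-involutive (proj₁ u)))

  ι-kernel : ∀ {W : OML c} (h : Hom X W) b → b ≈ upper h (OML.𝟏 W) → IsKernel (ι X b) h
  ι-kernel {W} h b b≈h𝟏 = annihilated , universal
    where
    annihilated : h ∘ ι X b ≃ zeroHom (↓ X b) W
    annihilated = annihilates⇐ h (ι X b) λ u →
      trans (ᗮᗮ-≤ _) (trans (proj₂ u) (reflexive b≈h𝟏))

    universal : ∀ {Z : OML c} (g : Hom Z X) → h ∘ g ≃ zeroHom Z W →
                Σ[ φ ∈ Hom Z (↓ X b) ] ((ι X b ∘ φ ≃ g) × (∀ ψ → ι X b ∘ ψ ≃ g → ψ ≃ φ))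
    universal g hg≃0 = (ι X b † ∘ g) , factored ,
      λ ψ bψ≃g → ι-monic b ψ (ι X b † ∘ g)
        (≃-trans (ι X b ∘ ψ) g (ι X b ∘ (ι X b † ∘ g)) bψ≃g (≃-sym (ι X b ∘ (ι X b † ∘ g)) g factored))
      where
      factored : ι X b ∘ (ι X b † ∘ g) ≃ g
      factored = ι-factor b g λ z →
        trans (annihilates⇒ h g hg≃0 z) (reflexive (Eq.sym b≈h𝟏))

  dagger-kernel-exists : ∀ {W : OML c} (h : Hom X W) →
                         Σ[ C ∈ OML c ] Σ[ k ∈ Hom C X ] IsDaggerKernelOf k h
  dagger-kernel-exists {W} h =
    ↓ X (upper h (OML.𝟏 W)) , ι X _ , ι-kernel h _ Eq.refl , ι-dagger-mono _

  kernel-top : ∀ {C W : OML c} (k : Hom C X) (h : Hom X W) →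
               IsKernel k h → lower k (OML.𝟏 C) ≈ upper h (OML.𝟏 W) ᗮ
  kernel-top {C} {W} k h k-kernel = antisym
    (top-least k (ι X h𝟏) (kernels-comparable (ι X h𝟏) k h (ι-kernel h h𝟏 Eq.refl) k-kernel) (h𝟏 , refl))
    (ᗮ-swap′ (annihilates⇒ h k (proj₁ k-kernel) (OML.𝟏 C)))
    where
    h𝟏 : Carrier
    h𝟏 = upper h (OML.𝟏 W)

  -- a : ↓a → X is a dagger kernel, namely of (aᗮ)†, since (aᗮ)ᗮ ≈ a.
  ι-dagger-kernel : ∀ a → IsDaggerKernel (ι X a)
  ι-dagger-kernel a =
    (↓ X (a ᗮ) , ι X (a ᗮ) † , ι-kernel (ι X (a ᗮ) †) a (Eq.sym (ᗮ-involutive a))) , ι-dagger-mono a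

  -- a ↦ (a : ↓a → X) reflects and preserves order: ι a ⊑ ι b iff every
  -- u ≤ a satisfies uᗮᗮ ≤ b, i.e. iff a ≤ b.
  ι-order-embedding : ∀ a b → (a ≤ b → ι X a ⊑ ι X b) × (ι X a ⊑ ι X b → a ≤ b)
  ι-order-embedding a b =
    (λ a≤b → below⇒⊑ι b (ι X a) λ u → trans (ᗮᗮ-≤ _) (trans (proj₂ u) a≤b))
    , (λ a⊑b → trans (≤-ᗮᗮ a) (⊑ι⇒below b (ι X a) a⊑b (a , refl)))

  ι-onto : ∀ {M} (m : Hom M X) → IsDaggerKernel m → Σ[ a ∈ Carrier ] ((m ⊑ ι X a) × (ι X a ⊑ m))
  ι-onto m ((W , f , m-kernel) , _) = upper f (OML.𝟏 W) ,
    kernels-comparable m (ι X _) f m-kernel (ι-kernel f _ Eq.refl) ,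
    kernels-comparable (ι X _) m f (ι-kernel f _ Eq.refl) m-kernel

-- ∃_f(x) = ker(coker(f ∘ x)) corresponds to f_*(x)ᗮ.
direct-image : ∀ {c} {X Y : OML c} (f : Hom X Y) x {C : OML c} (k : Hom C Y) →
               IsDaggerKernelOf k ((f ∘ ι X x) †) → IsKernel (ι Y (OML._ᗮ Y (lower f x))) (k †)
direct-image {X = X} {Y} f x k (k-kernel , _) = Kernels.ι-kernel Y (k †) _
  (OML.Eq.sym Y (OML.Eq.trans Y (Kernels.kernel-top Y k ((f ∘ ι X x) †) k-kernel)
    (Orthocomplement.ᗮ-cong Y (lower-cong f (OML.ᗮ-involutive X x)))))

-- f⁻¹(y) = ker(coker(y) ∘ f) corresponds to f^*(yᗮ).
inverse-image : ∀ {c} {X Y : OML c} (f : Hom X Y) y {C : OML c} (k : Hom C Y) →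
                IsDaggerKernelOf k (ι Y y †) → IsKernel (ι X (upper f (OML._ᗮ Y y))) ((k †) ∘ f)
inverse-image {X = X} {Y} f y k (k-kernel , _) = Kernels.ι-kernel X ((k †) ∘ f) _
  (upper-cong f (OML.Eq.sym Y (OML.Eq.trans Y
    (Orthocomplement.ᗮ-cong Y (Kernels.kernel-top Y k (ι Y y †) k-kernel))
    (OML.ᗮ-involutive Y (OML._ᗮ Y y)))))

proposition3p9 : ∀ {c : Level} (X : OML c) →
    (∀ (a : OML.Carrier X) → IsDaggerKernel (ι X a))
    × (∀ (a b : OML.Carrier X) →
         (OML._≤_ X a b → ι X a ⊑ ι X b) × (ι X a ⊑ ι X b → OML._≤_ X a b))
    × (∀ {M : OML c} (m : Hom M X) → IsDaggerKernel m →
         Σ[ a ∈ OML.Carrier X ] ((m ⊑ ι X a) × (ι X a ⊑ m)))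
    × (∀ (a : OML.Carrier X) → IsKernel (ι X (OML._ᗮ X a)) (ι X a †))
    × (∀ {Y : OML c} (f : Hom X Y) →
         (∀ (x : OML.Carrier X) →
            (Σ[ C ∈ OML c ] Σ[ k ∈ Hom C Y ] IsDaggerKernelOf k ((f ∘ ι X x) †))
            × (∀ {C : OML c} (k : Hom C Y) → IsDaggerKernelOf k ((f ∘ ι X x) †) →
                 IsKernel (ι Y (OML._ᗮ Y (lower f x))) (k †)))
         × (∀ (y : OML.Carrier Y) →
            (Σ[ C ∈ OML c ] Σ[ k ∈ Hom C Y ] IsDaggerKernelOf k (ι Y y †))
            × (∀ {C : OML c} (k : Hom C Y) → IsDaggerKernelOf k (ι Y y †) →
                 IsKernel (ι X (upper f (OML._ᗮ Y y))) ((k †) ∘ f))))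
proposition3p9 X =
  ι-dagger-kernel , ι-order-embedding , ι-onto ,
  -- aᗮ is the kernel of a†, whose upper adjoint sends 𝟏 to aᗮ.
  (λ a → ι-kernel (ι X a †) (OML._ᗮ X a) (OML.Eq.refl X)) ,
  λ {Y} f →
    (λ x → Kernels.dagger-kernel-exists Y ((f ∘ ι X x) †) , direct-image f x) ,
    (λ y → Kernels.dagger-kernel-exists Y (ι Y y †) , inverse-image f y)
  where open Kernels X
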